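{- Let $a$ and $b$ be relatively prime positive integers, let $k \ge 1$ and $m \ge 0$ be integers. Let $R_k(a,b)$ be the set of all nonnegative integers $j$ having exactly $k$ representations $j = pa + qb$ with $(p, q) \in \mathbb{Z}_{\ge 0}^2$, and let $s_k^m(a,b) = \sum_{j \in R_k(a,b)} j^m$. Then \[ s_k^m(a,b) \ = \ \sum_{ \lambda + \mu + \nu = m } \binom{ m }{ \lambda \ \mu \ \nu } a^{ \lambda + \mu } b^{ \lambda + \nu } (k-1)^\lambda \beta_{ \nu + 1 } (a) \, \beta_{ \mu + 1 } (b) \, , \] where the sum is over all triples $(\lambda,\mu,\nu)$ of nonnegative integers with $\lambda+\mu+\nu = m$.
   Context: The number of representations of $j$ is the number of pairs $(p,q) \in \mathbb{Z}_{\ge 0}^2$ with $pa+qb=j$. $\binom{m}{\lambda\ \mu\ \nu} = \frac{m!}{\lambda!\,\mu!\,\nu!}$ is the multinomial coefficient, and $0^0 = 1$. The Bernoulli polynomials $B_n(x)$ are defined by $\frac{z e^{xz}}{e^z - 1} = \sum_{n \ge 0} \frac{B_n(x)}{n!} z^n$, and for $k \ge 1$, $\beta_k(x) := \frac{1}{k}\left(B_k(x) - B_k(0)\right)$; for positive integers $x$ one has $\beta_k(x) = \sum_{j=0}^{x-1} j^{k-1}$ (with $0^0=1$). -}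

module Defs where

open import Data.Nat using (ℕ; zero; suc; _+_; _*_; _∸_; _^_; _≡ᵇ_; _/_; _!; NonZero)
open import Data.Nat.Properties using (_!≢0; m*n≢0)
open import Data.Bool using (if_then_else_)

sumBelow : ℕ → (ℕ → ℕ) → ℕ
sumBelow zero    f = 0
sumBelow (suc n) f = sumBelow n f + f n

-- For a, b ≥ 1 every such pair has p ≤ j and q ≤ j, so we count over
-- the box [0, j] × [0, j]; the number of representations is
-- then exactly the number of pairs (p,q) ∈ ℕ² with p*a+q*b = j.
numReps : ℕ → ℕ → ℕ → ℕ
numReps a b j =
  sumBelow (suc j) λ p → sumBelow (suc j) λ q →
    if (p * a + q * b) ≡ᵇ j then 1 else 0

partialS : ℕ → ℕ → ℕ → ℕ → ℕ → ℕ
partialS k m a b N =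
  sumBelow N λ j → if numReps a b j ≡ᵇ k then j ^ m else 0

multinomial : ℕ → ℕ → ℕ → ℕ → ℕ
multinomial m l u v =
  (m ! / (l ! * u ! * v !)) {{m*n≢0 (l ! * u !) (v !) {{m*n≢0 (l !) (u !) {{l !≢0}} {{u !≢0}}}} {{v !≢0}}}}

-- β_k(x) for positive integers x:  β_k(x) = Σ_{j=0}^{x-1} j^(k-1), 0^0 = 1
-- (ℕ's _^_ has 0 ^ 0 = 1).  Only used at k ≥ 1 and x ≥ 1.
β : ℕ → ℕ → ℕ
β k x = sumBelow x λ j → j ^ (k ∸ 1)

rhs : ℕ → ℕ → ℕ → ℕ → ℕ
rhs k m a b =
  sumBelow (suc m) λ l → sumBelow (suc (m ∸ l)) λ u →
    let v = m ∸ l ∸ u in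
    multinomial m l u v * a ^ (l + u) * b ^ (l + v) * (k ∸ 1) ^ l
      * β (v + 1) a * β (u + 1) b

module Submission where

-- Let a, b ≥ 1 be coprime and put  c(n,p,q) = q·a + (p + n·a)·b.  The integers
-- with exactly n+1 representations j = x·a + y·b are precisely the c(n,p,q)
-- with p < a, q < b, and these are pairwise distinct: the representations of
-- c(n,p,q) are x = q + t·b, y = p + (n-t)·a for t ≤ n (coprimality fixes x
-- mod b), and every representable integer is some c(K,p,q).  Hence all such j
-- lie below c(n,a,b), and  s_{n+1}^m = Σ_{p<a} Σ_{q<b} c(n,p,q)^m.  Since
-- c(n,p,q) = n·ab + a·q + b·p, the trinomial theorem together with
-- β_{ν+1}(x) = Σ_{j<x} j^ν turns the same double sum into the right-hand side.

open import Defs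
open import Data.Nat using (ℕ; _≤_; _≥_)
open import Data.Nat.Coprimality using (Coprime)
open import Data.Product using (Σ; _×_)
open import Relation.Binary.PropositionalEquality using (_≡_; _≢_)

open import Data.Nat
open import Data.Nat.Properties
open import Data.Nat.Combinatorics using (_C_; nCk≡n!/k![n-k]!; k![n∸k]!∣n!)
open import Data.Nat.DivMod using (m≡m%n+[m/n]*n; m%n<n; m/n*n≡m; m*n/n≡m; /-congˡ)
open import Data.Nat.Divisibility using (_∣_; divides; >⇒∤)
open import Data.Nat.Coprimality using (coprime-divisor)
import Data.Nat.Coprimality as Coprimality
open import Data.Nat.Tactic.RingSolver using (solve-∀)
open import Data.Bool using (Bool; true; false; if_then_else_)
open import Data.Bool.Properties using (T-≡; ¬-not)
open import Data.Fin using (Fin; toℕ)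
open import Data.Product using (_,_; ∃-syntax)
open import Data.Sum using (_⊎_; inj₁; inj₂)
open import Data.Empty using (⊥-elim)
open import Relation.Nullary using (¬_; yes; no)
open import Function.Bundles using (Equivalence)
open import Relation.Binary.PropositionalEquality using (refl; sym; trans; cong; cong₂; subst; module ≡-Reasoning)

import Algebra.Properties.CommutativeSemiring.Binomial +-*-commutativeSemiring as Binomial
import Algebra.Properties.CommutativeSemiring.Exp +-*-commutativeSemiring as CommutativeExp
import Algebra.Properties.Semiring.Exp +-*-semiring as SemiringExp
import Algebra.Properties.Semiring.Mult +-*-semiring as SemiringMult
import Algebra.Properties.Semiring.Sum +-*-semiring as SemiringSum

≡ᵇ-sound : ∀ {x y} → (x ≡ᵇ y) ≡ true → x ≡ y
≡ᵇ-sound {x} {y} test = ≡ᵇ⇒≡ x y (Equivalence.from T-≡ test)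

≡ᵇ-complete : ∀ {x y} → x ≡ y → (x ≡ᵇ y) ≡ true
≡ᵇ-complete {x} {y} x≡y = Equivalence.to T-≡ (≡⇒≡ᵇ x y x≡y)

if-≡ᵇ-yes : ∀ {A : Set} {x y} (u v : A) → x ≡ y → (if x ≡ᵇ y then u else v) ≡ u
if-≡ᵇ-yes u v x≡y rewrite ≡ᵇ-complete x≡y = refl

if-≡ᵇ-no : ∀ {A : Set} {x y} (u v : A) → x ≢ y → (if x ≡ᵇ y then u else v) ≡ v
if-≡ᵇ-no {x = x} {y} u v x≢y rewrite ¬-not {x ≡ᵇ y} {true} (λ test → x≢y (≡ᵇ-sound test)) = refl

false≢true : false ≢ true
false≢true ()

-- Case analysis on a boolean term that keeps the term itself in the goal.
true-or-false : ∀ (c : Bool) → c ≡ true ⊎ c ≡ false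
true-or-false true  = inj₁ refl
true-or-false false = inj₂ refl

sum-cong : ∀ n {f g : ℕ → ℕ} → (∀ i → i < n → f i ≡ g i) → sumBelow n f ≡ sumBelow n g
sum-cong zero    f≡g = refl
sum-cong (suc n) f≡g = cong₂ _+_ (sum-cong n (λ i i<n → f≡g i (m<n⇒m<1+n i<n))) (f≡g n ≤-refl)

sum-zero : ∀ n {f : ℕ → ℕ} → (∀ i → i < n → f i ≡ 0) → sumBelow n f ≡ 0
sum-zero n f≡0 = trans (sum-cong n f≡0) (zero-sum n)
  where
  zero-sum : ∀ n → sumBelow n (λ _ → 0) ≡ 0
  zero-sum zero    = refl
  zero-sum (suc n) = cong (_+ 0) (zero-sum n)

sum-ones : ∀ n → sumBelow n (λ _ → 1) ≡ n
sum-ones zero    = refl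
sum-ones (suc n) = trans (cong (_+ 1) (sum-ones n)) (+-comm n 1)

sum-+ : ∀ n (f g : ℕ → ℕ) → sumBelow n (λ i → f i + g i) ≡ sumBelow n f + sumBelow n g
sum-+ zero    f g = refl
sum-+ (suc n) f g rewrite sum-+ n f g = interchange (sumBelow n f) (sumBelow n g) (f n) (g n)
  where
  interchange : ∀ w x y z → w + x + (y + z) ≡ w + y + (x + z)
  interchange = solve-∀

sum-*ˡ : ∀ n c (f : ℕ → ℕ) → sumBelow n (λ i → c * f i) ≡ c * sumBelow n f
sum-*ˡ zero    c f = sym (*-zeroʳ c)
sum-*ˡ (suc n) c f rewrite sum-*ˡ n c f = sym (*-distribˡ-+ c (sumBelow n f) (f n))

sum-*ʳ : ∀ n c (f : ℕ → ℕ) → sumBelow n (λ i → f i * c) ≡ sumBelow n f * c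
sum-*ʳ zero    c f = refl
sum-*ʳ (suc n) c f rewrite sum-*ʳ n c f = sym (*-distribʳ-+ c (sumBelow n f) (f n))

sum-swap : ∀ n m (f : ℕ → ℕ → ℕ) →
  sumBelow n (λ i → sumBelow m (λ j → f i j)) ≡ sumBelow m (λ j → sumBelow n (λ i → f i j))
sum-swap zero    m f = sym (sum-zero m (λ _ _ → refl))
sum-swap (suc n) m f rewrite sum-swap n m f = sym (sum-+ m (λ j → sumBelow n (λ i → f i j)) (λ j → f n j))

sum-swap-pairs : ∀ L (U : ℕ → ℕ) A B (F : ℕ → ℕ → ℕ → ℕ → ℕ) →
  sumBelow L (λ l → sumBelow (U l) (λ u → sumBelow A (λ p → sumBelow B (λ q → F l u p q)))) ≡
  sumBelow A (λ p → sumBelow B (λ q → sumBelow L (λ l → sumBelow (U l) (λ u → F l u p q))))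
sum-swap-pairs L U A B F = begin
  sumBelow L (λ l → sumBelow (U l) (λ u → sumBelow A (λ p → sumBelow B (λ q → F l u p q))))
    ≡⟨ sum-cong L (λ l _ → sum-swap (U l) A (λ u p → sumBelow B (λ q → F l u p q))) ⟩
  sumBelow L (λ l → sumBelow A (λ p → sumBelow (U l) (λ u → sumBelow B (λ q → F l u p q))))
    ≡⟨ sum-cong L (λ l _ → sum-cong A (λ p _ → sum-swap (U l) B (λ u q → F l u p q))) ⟩
  sumBelow L (λ l → sumBelow A (λ p → sumBelow B (λ q → sumBelow (U l) (λ u → F l u p q))))
    ≡⟨ sum-swap L A (λ l p → sumBelow B (λ q → sumBelow (U l) (λ u → F l u p q))) ⟩
  sumBelow A (λ p → sumBelow L (λ l → sumBelow B (λ q → sumBelow (U l) (λ u → F l u p q))))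
    ≡⟨ sum-cong A (λ p _ → sum-swap L B (λ l q → sumBelow (U l) (λ u → F l u p q))) ⟩
  sumBelow A (λ p → sumBelow B (λ q → sumBelow L (λ l → sumBelow (U l) (λ u → F l u p q)))) ∎
  where open ≡-Reasoning

sum-product : ∀ A B c (f g : ℕ → ℕ) →
  c * sumBelow A f * sumBelow B g ≡ sumBelow A (λ p → sumBelow B (λ q → c * f p * g q))
sum-product A B c f g = begin
  c * sumBelow A f * sumBelow B g            ≡⟨ cong (_* sumBelow B g) (sym (sum-*ˡ A c f)) ⟩
  sumBelow A (λ p → c * f p) * sumBelow B g  ≡⟨ sym (sum-*ʳ A (sumBelow B g) (λ p → c * f p)) ⟩
  sumBelow A (λ p → c * f p * sumBelow B g)  ≡⟨ sum-cong A (λ p _ → sym (sum-*ˡ B (c * f p) g)) ⟩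
  sumBelow A (λ p → sumBelow B (λ q → c * f p * g q)) ∎
  where open ≡-Reasoning

sum-nonzero : ∀ n (f : ℕ → ℕ) → sumBelow n f ≢ 0 → ∃[ i ] i < n × f i ≢ 0
sum-nonzero zero    f sum≢0 = ⊥-elim (sum≢0 refl)
sum-nonzero (suc n) f sum≢0 with f n ≟ 0
... | no  fn≢0 = n , ≤-refl , fn≢0
... | yes fn≡0 with sum-nonzero n f (λ sum≡0 → sum≢0 (cong₂ _+_ sum≡0 fn≡0))
...   | i , i<n , fi≢0 = i , m<n⇒m<1+n i<n , fi≢0

sum-single : ∀ n i₀ (f : ℕ → ℕ) → i₀ < n →
  (∀ i → i < n → i ≢ i₀ → f i ≡ 0) → sumBelow n f ≡ f i₀
sum-single (suc n) i₀ f i₀<1+n others with m<1+n⇒m<n∨m≡n i₀<1+n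
... | inj₁ i₀<n =
  trans (cong₂ _+_ (sum-single n i₀ f i₀<n (λ i i<n → others i (m<n⇒m<1+n i<n)))
                   (others n ≤-refl (λ n≡i₀ → <-irrefl (sym n≡i₀) i₀<n)))
        (+-identityʳ (f i₀))
... | inj₂ refl =
  cong (_+ f i₀)
    (sum-zero i₀ (λ i i<i₀ → others i (m<n⇒m<1+n i<i₀) (λ i≡i₀ → <-irrefl i≡i₀ i<i₀)))

sum-single₂ : ∀ A B p₀ q₀ (F : ℕ → ℕ → ℕ) → p₀ < A → q₀ < B →
  (∀ p q → p < A → q < B → ¬ (p ≡ p₀ × q ≡ q₀) → F p q ≡ 0) →
  sumBelow A (λ p → sumBelow B (λ q → F p q)) ≡ F p₀ q₀
sum-single₂ A B p₀ q₀ F p₀<A q₀<B others =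
  trans (sum-single A p₀ (λ p → sumBelow B (F p)) p₀<A
          (λ p p<A p≢p₀ → sum-zero B (λ q q<B →
             others p q p<A q<B (λ (p≡p₀ , _) → p≢p₀ p≡p₀))))
        (sum-single B q₀ (F p₀) q₀<B
          (λ q q<B q≢q₀ → others p₀ q p₀<A q<B (λ (_ , q≡q₀) → q≢q₀ q≡q₀)))

count-parametrised : ∀ N K (P : ℕ → ℕ → Bool) (X Y : ℕ → ℕ) →
  (∀ {t t'} → X t ≡ X t' → t ≡ t') →
  (∀ t → t < K → X t < N × Y t < N × P (X t) (Y t) ≡ true) →
  (∀ x y → P x y ≡ true → ∃[ t ] t < K × x ≡ X t × y ≡ Y t) →
  sumBelow N (λ x → sumBelow N (λ y → if P x y then 1 else 0)) ≡ K
count-parametrised N K P X Y X-injective parametrisation solutions = begin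
  sumBelow N (λ x → sumBelow N (λ y → if P x y then 1 else 0))
    ≡⟨ sum-cong N (λ x _ → sum-cong N (λ y _ → indicator-as-sum x y)) ⟩
  sumBelow N (λ x → sumBelow N (λ y → sumBelow K (δ x y)))
    ≡⟨ sum-cong N (λ x _ → sum-swap N K (δ x)) ⟩
  sumBelow N (λ x → sumBelow K (λ t → sumBelow N (λ y → δ x y t)))
    ≡⟨ sum-swap N K (λ x t → sumBelow N (λ y → δ x y t)) ⟩
  sumBelow K (λ t → sumBelow N (λ x → sumBelow N (λ y → δ x y t)))
    ≡⟨ sum-cong K (λ t t<K → one-solution-per-parameter t t<K) ⟩
  sumBelow K (λ _ → 1)
    ≡⟨ sum-ones K ⟩
  K ∎
  where
  open ≡-Reasoning
  indicator : Bool → ℕ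
  indicator c = if c then 1 else 0

  δ : ℕ → ℕ → ℕ → ℕ
  δ x y t = if x ≡ᵇ X t then indicator (P x y) else 0

  δ-off : ∀ {x y t} → x ≢ X t → δ x y t ≡ 0
  δ-off {x} {y} = if-≡ᵇ-no (indicator (P x y)) 0

  δ-on : ∀ {x y t} → x ≡ X t → δ x y t ≡ indicator (P x y)
  δ-on {x} {y} = if-≡ᵇ-yes (indicator (P x y)) 0

  -- Each solution has exactly one parameter.
  indicator-as-sum : ∀ x y → indicator (P x y) ≡ sumBelow K (δ x y)
  indicator-as-sum x y with true-or-false (P x y)
  ... | inj₂ unsolved = trans (cong indicator unsolved) (sym (sum-zero K (λ t _ → no-parameter t)))
    where
    no-parameter : ∀ t → δ x y t ≡ 0
    no-parameter t with x ≟ X t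
    ... | no  x≢Xt = δ-off x≢Xt
    ... | yes x≡Xt = trans (δ-on x≡Xt) (cong indicator unsolved)
  ... | inj₁ solved with solutions x y solved
  ...   | t₀ , t₀<K , x≡Xt₀ , _ =
    sym (trans (sum-single K t₀ (δ x y) t₀<K
                 (λ t _ t≢t₀ → δ-off (λ x≡Xt → t≢t₀ (X-injective (trans (sym x≡Xt) x≡Xt₀)))))
               (δ-on x≡Xt₀))

  one-solution-per-parameter : ∀ t → t < K → sumBelow N (λ x → sumBelow N (λ y → δ x y t)) ≡ 1
  one-solution-per-parameter t t<K with parametrisation t t<K
  ... | Xt<N , Yt<N , solved =
    trans (sum-single₂ N N (X t) (Y t) (λ x y → δ x y t) Xt<N Yt<N others)
          (trans (δ-on refl) (cong indicator solved))
    where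
    others : ∀ x y → x < N → y < N → ¬ (x ≡ X t × y ≡ Y t) → δ x y t ≡ 0
    others x y _ _ not-here with x ≟ X t
    ... | no  x≢Xt = δ-off x≢Xt
    ... | yes x≡Xt with true-or-false (P x y)
    ...   | inj₂ unsolved = trans (δ-on x≡Xt) (cong indicator unsolved)
    ...   | inj₁ solved′ with solutions x y solved′
    ...     | t′ , _ , x≡Xt′ , y≡Yt′ =
      ⊥-elim (not-here (x≡Xt , trans y≡Yt′ (cong Y (X-injective (trans (sym x≡Xt′) x≡Xt)))))

sum-reindex : ∀ N A B (Q : ℕ → Bool) (g : ℕ → ℕ → ℕ) (f : ℕ → ℕ) →
  (∀ {p q p' q'} → p < A → q < B → p' < A → q' < B → g p q ≡ g p' q' → p ≡ p' × q ≡ q') →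
  (∀ p q → p < A → q < B → g p q < N × Q (g p q) ≡ true) →
  (∀ j → Q j ≡ true → ∃[ p ] ∃[ q ] p < A × q < B × j ≡ g p q) →
  sumBelow N (λ j → if Q j then f j else 0) ≡ sumBelow A (λ p → sumBelow B (λ q → f (g p q)))
sum-reindex N A B Q g f g-injective g-image Q-in-image = begin
  sumBelow N (λ j → if Q j then f j else 0)
    ≡⟨ sum-cong N (λ j _ → filter-as-sum j) ⟩
  sumBelow N (λ j → sumBelow A (λ p → sumBelow B (λ q → ε j p q)))
    ≡⟨ sum-swap N A (λ j p → sumBelow B (λ q → ε j p q)) ⟩
  sumBelow A (λ p → sumBelow N (λ j → sumBelow B (λ q → ε j p q)))
    ≡⟨ sum-cong A (λ p _ → sum-swap N B (λ j q → ε j p q)) ⟩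
  sumBelow A (λ p → sumBelow B (λ q → sumBelow N (λ j → ε j p q)))
    ≡⟨ sum-cong A (λ p p<A → sum-cong B (λ q q<B → evaluate p q p<A q<B)) ⟩
  sumBelow A (λ p → sumBelow B (λ q → f (g p q))) ∎
  where
  open ≡-Reasoning
  ε : ℕ → ℕ → ℕ → ℕ
  ε j p q = if j ≡ᵇ g p q then f j else 0

  -- A term passing the filter is hit by exactly one index pair.
  filter-as-sum : ∀ j → (if Q j then f j else 0) ≡ sumBelow A (λ p → sumBelow B (λ q → ε j p q))
  filter-as-sum j with true-or-false (Q j)
  ... | inj₂ fails =
    trans (cong (λ c → if c then f j else 0) fails)
          (sym (sum-zero A (λ p p<A → sum-zero B (λ q q<B → missed p q p<A q<B))))
    where
    missed : ∀ p q → p < A → q < B → ε j p q ≡ 0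
    missed p q p<A q<B with j ≟ g p q
    ... | no  j≢g = if-≡ᵇ-no (f j) 0 j≢g
    ... | yes refl with g-image p q p<A q<B
    ...   | _ , passes = ⊥-elim (false≢true (trans (sym fails) passes))
  ... | inj₁ passes with Q-in-image j passes
  ...   | p₀ , q₀ , p₀<A , q₀<B , j≡g₀ =
    trans (cong (λ c → if c then f j else 0) passes)
          (sym (trans (sum-single₂ A B p₀ q₀ (ε j) p₀<A q₀<B others) (if-≡ᵇ-yes (f j) 0 j≡g₀)))
    where
    others : ∀ p q → p < A → q < B → ¬ (p ≡ p₀ × q ≡ q₀) → ε j p q ≡ 0
    others p q p<A q<B not-here =
      if-≡ᵇ-no (f j) 0 (λ j≡g → not-here (g-injective p<A q<B p₀<A q₀<B (trans (sym j≡g) j≡g₀)))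

  evaluate : ∀ p q → p < A → q < B → sumBelow N (λ j → ε j p q) ≡ f (g p q)
  evaluate p q p<A q<B with g-image p q p<A q<B
  ... | g<N , _ =
    trans (sum-single N (g p q) (λ j → ε j p q) g<N (λ j _ j≢g → if-≡ᵇ-no (f j) 0 j≢g))
          (if-≡ᵇ-yes {x = g p q} (f (g p q)) 0 refl)

-- The library states the binomial theorem for an arbitrary commutative
-- semiring, with iterated addition/multiplication and Fin-indexed sums;
-- over ℕ these agree with _*_, _^_ and sumBelow.
×≡* : ∀ n x → n SemiringMult.× x ≡ n * x
×≡* zero    x = refl
×≡* (suc n) x = cong (x +_) (×≡* n x)

^≡^ : ∀ x n → x SemiringExp.^ n ≡ x ^ n
^≡^ x zero    = refl
^≡^ x (suc n) = cong (x *_) (^≡^ x n)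

sum-shift : ∀ n (f : ℕ → ℕ) → sumBelow (suc n) f ≡ f 0 + sumBelow n (λ i → f (suc i))
sum-shift zero    f = sym (+-identityʳ (f 0))
sum-shift (suc n) f rewrite sum-shift n f = +-assoc (f 0) _ _

sumBelow≡sum : ∀ n (f : ℕ → ℕ) → sumBelow n f ≡ SemiringSum.sum (λ (i : Fin n) → f (toℕ i))
sumBelow≡sum zero    f = refl
sumBelow≡sum (suc n) f = trans (sum-shift n f) (cong (f 0 +_) (sumBelow≡sum n (λ i → f (suc i))))

^-distrib-* : ∀ x y n → (x * y) ^ n ≡ x ^ n * y ^ n
^-distrib-* x y n = begin
  (x * y) ^ n                              ≡⟨ sym (^≡^ (x * y) n) ⟩
  (x * y) SemiringExp.^ n                  ≡⟨ CommutativeExp.^-distrib-* x y n ⟩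
  x SemiringExp.^ n * y SemiringExp.^ n    ≡⟨ cong₂ _*_ (^≡^ x n) (^≡^ y n) ⟩
  x ^ n * y ^ n ∎
  where open ≡-Reasoning

binomial : ∀ n x y → (x + y) ^ n ≡ sumBelow (suc n) (λ k → (n C k) * x ^ k * y ^ (n ∸ k))
binomial n x y = begin
  (x + y) ^ n                       ≡⟨ sym (^≡^ (x + y) n) ⟩
  (x + y) SemiringExp.^ n           ≡⟨ Binomial.theorem n x y ⟩
  Binomial.binomialExpansion x y n  ≡⟨ SemiringSum.sum-cong-≗ {suc n} (λ k → term (toℕ k)) ⟩
  SemiringSum.sum (λ (k : Fin (suc n)) → (n C toℕ k) * x ^ toℕ k * y ^ (n ∸ toℕ k))
                                    ≡⟨ sym (sumBelow≡sum (suc n) _) ⟩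
  sumBelow (suc n) (λ k → (n C k) * x ^ k * y ^ (n ∸ k)) ∎
  where
  open ≡-Reasoning
  term : ∀ k → (n C k) SemiringMult.× (x SemiringExp.^ k * y SemiringExp.^ (n ∸ k))
                ≡ (n C k) * x ^ k * y ^ (n ∸ k)
  term k = begin
    (n C k) SemiringMult.× (x SemiringExp.^ k * y SemiringExp.^ (n ∸ k))
      ≡⟨ ×≡* (n C k) _ ⟩
    (n C k) * (x SemiringExp.^ k * y SemiringExp.^ (n ∸ k))
      ≡⟨ cong₂ (λ u v → (n C k) * (u * v)) (^≡^ x k) (^≡^ y (n ∸ k)) ⟩
    (n C k) * (x ^ k * y ^ (n ∸ k))
      ≡⟨ sym (*-assoc (n C k) _ _) ⟩
    (n C k) * x ^ k * y ^ (n ∸ k) ∎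

C*factorials : ∀ n k → k ≤ n → (n C k) * (k ! * (n ∸ k) !) ≡ n !
C*factorials n k k≤n =
  trans (cong (_* (k ! * (n ∸ k) !)) (nCk≡n!/k![n-k]! k≤n))
        (m/n*n≡m {{m*n≢0 (k !) ((n ∸ k) !) {{k !≢0}} {{(n ∸ k) !≢0}}}} (k![n∸k]!∣n! k≤n))

multinomial-split : ∀ m l u → l ≤ m → u ≤ m ∸ l →
  multinomial m l u (m ∸ l ∸ u) ≡ (m C l) * ((m ∸ l) C u)
multinomial-split m l u l≤m u≤m∸l =
  trans (/-congˡ (sym product*denominator)) (m*n/n≡m ((m C l) * ((m ∸ l) C u)) denominator)
  where
  open ≡-Reasoning
  denominator = l ! * u ! * (m ∸ l ∸ u) !
  instance
    _ = m*n≢0 (l ! * u !) ((m ∸ l ∸ u) !) {{m*n≢0 (l !) (u !) {{l !≢0}} {{u !≢0}}}} {{(m ∸ l ∸ u) !≢0}}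
  regroup : ∀ c l! d u! v! → c * d * (l! * u! * v!) ≡ c * (l! * (d * (u! * v!)))
  regroup = solve-∀
  product*denominator : (m C l) * ((m ∸ l) C u) * denominator ≡ m !
  product*denominator = begin
    (m C l) * ((m ∸ l) C u) * denominator
      ≡⟨ regroup (m C l) (l !) ((m ∸ l) C u) (u !) ((m ∸ l ∸ u) !) ⟩
    (m C l) * (l ! * (((m ∸ l) C u) * (u ! * (m ∸ l ∸ u) !)))
      ≡⟨ cong (λ r → (m C l) * (l ! * r)) (C*factorials (m ∸ l) u u≤m∸l) ⟩
    (m C l) * (l ! * (m ∸ l) !)
      ≡⟨ C*factorials m l l≤m ⟩
    m ! ∎

trinomial : ∀ m x y z → (x + (y + z)) ^ m ≡
  sumBelow (suc m) (λ l → sumBelow (suc (m ∸ l)) (λ u →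
    multinomial m l u (m ∸ l ∸ u) * x ^ l * y ^ u * z ^ (m ∸ l ∸ u)))
trinomial m x y z = trans (binomial m x (y + z)) (sum-cong (suc m) λ l l<1+m → begin
  (m C l) * x ^ l * (y + z) ^ (m ∸ l)
    ≡⟨ cong ((m C l) * x ^ l *_) (binomial (m ∸ l) y z) ⟩
  (m C l) * x ^ l * sumBelow (suc (m ∸ l)) (λ u → ((m ∸ l) C u) * y ^ u * z ^ (m ∸ l ∸ u))
    ≡⟨ sym (sum-*ˡ (suc (m ∸ l)) ((m C l) * x ^ l) _) ⟩
  sumBelow (suc (m ∸ l)) (λ u → (m C l) * x ^ l * (((m ∸ l) C u) * y ^ u * z ^ (m ∸ l ∸ u)))
    ≡⟨ sum-cong (suc (m ∸ l)) (λ u u<1+m∸l → trans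
         (regroup (m C l) (x ^ l) ((m ∸ l) C u) (y ^ u) (z ^ (m ∸ l ∸ u)))
         (cong (λ c → c * x ^ l * y ^ u * z ^ (m ∸ l ∸ u))
               (sym (multinomial-split m l u (≤-pred l<1+m) (≤-pred u<1+m∸l))))) ⟩
  sumBelow (suc (m ∸ l)) (λ u → multinomial m l u (m ∸ l ∸ u) * x ^ l * y ^ u * z ^ (m ∸ l ∸ u)) ∎)
  where
  open ≡-Reasoning
  regroup : ∀ c xl d yu zv → c * xl * (d * yu * zv) ≡ c * d * xl * yu * zv
  regroup = solve-∀

-- The integer with n+1 representations attached to the residues p < a, q < b.
canonical : ℕ → ℕ → ℕ → ℕ → ℕ → ℕ
canonical a b n p q = q * a + (p + n * a) * b

multiple-below : ∀ {b d} → b ∣ d → d < b → d ≡ 0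
multiple-below {d = zero}  _   _   = refl
multiple-below {d = suc _} b∣d d<b = ⊥-elim (>⇒∤ d<b b∣d)

module Representations (a b : ℕ) {{_ : NonZero a}} {{_ : NonZero b}} (coprime : Coprime a b) where

  residue-unique-≤ : ∀ {x x'} y y' → x ≤ x' → x' < b → x * a + y * b ≡ x' * a + y' * b → x ≡ x'
  residue-unique-≤ {x} {x'} y y' x≤x' x'<b same = begin
    x      ≡⟨ sym (+-identityʳ x) ⟩
    x + 0  ≡⟨ cong (x +_) (sym d≡0) ⟩
    x + d  ≡⟨ m+[n∸m]≡n x≤x' ⟩
    x'     ∎
    where
    open ≡-Reasoning
    d = x' ∸ x
    regroup : ∀ x d a y' b → (x + d) * a + y' * b ≡ x * a + (d * a + y' * b)
    regroup = solve-∀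
    shifted : d * a + y' * b ≡ y * b
    shifted = +-cancelˡ-≡ (x * a) _ _ (begin
      x * a + (d * a + y' * b)  ≡⟨ sym (regroup x d a y' b) ⟩
      (x + d) * a + y' * b      ≡⟨ cong (λ z → z * a + y' * b) (m+[n∸m]≡n x≤x') ⟩
      x' * a + y' * b           ≡⟨ sym same ⟩
      x * a + y * b             ∎)
    b∣a*d : b ∣ a * d
    b∣a*d = divides (y ∸ y') (begin
      a * d                    ≡⟨ *-comm a d ⟩
      d * a                    ≡⟨ sym (m+n∸n≡m (d * a) (y' * b)) ⟩
      d * a + y' * b ∸ y' * b  ≡⟨ cong (_∸ y' * b) shifted ⟩
      y * b ∸ y' * b           ≡⟨ sym (*-distribʳ-∸ b y y') ⟩
      (y ∸ y') * b             ∎)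
    d≡0 : d ≡ 0
    d≡0 = multiple-below (coprime-divisor (Coprimality.sym coprime) b∣a*d) (≤-<-trans (m∸n≤m x' x) x'<b)

  residue-unique : ∀ {x x'} y y' → x < b → x' < b → x * a + y * b ≡ x' * a + y' * b → x ≡ x'
  residue-unique {x} {x'} y y' x<b x'<b same with ≤-total x x'
  ... | inj₁ x≤x' = residue-unique-≤ y y' x≤x' x'<b same
  ... | inj₂ x'≤x = sym (residue-unique-≤ y' y x'≤x x<b (sym same))

  reduce-mod-b : ∀ x y → x * a + y * b ≡ (x % b) * a + (y + (x / b) * a) * b
  reduce-mod-b x y = trans (cong (λ z → z * a + y * b) (m≡m%n+[m/n]*n x b)) (regroup (x % b) (x / b) a b y)
    where
    regroup : ∀ r s a b y → (r + s * b) * a + y * b ≡ r * a + (y + s * a) * b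
    regroup = solve-∀

  canonical-form : ∀ x y → ∃[ K ] ∃[ p ] ∃[ q ] p < a × q < b × x * a + y * b ≡ canonical a b K p q
  canonical-form x y = Y / a , Y % a , x % b , m%n<n Y a , m%n<n x b ,
    trans (reduce-mod-b x y) (cong (λ z → x % b * a + z * b) (m≡m%n+[m/n]*n Y a))
    where
    Y = y + (x / b) * a

  canonical-representation : ∀ {n p q t} → t ≤ n →
    (q + t * b) * a + (p + (n ∸ t) * a) * b ≡ canonical a b n p q
  canonical-representation {n} {p} {q} {t} t≤n =
    trans (regroup q t b a p (n ∸ t)) (cong (λ s → q * a + (p + s * a) * b) (m+[n∸m]≡n t≤n))
    where
    regroup : ∀ q t b a p s → (q + t * b) * a + (p + s * a) * b ≡ q * a + (p + (t + s) * a) * b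
    regroup = solve-∀

  representations-of-canonical : ∀ {n p q x y} → p < a → q < b → x * a + y * b ≡ canonical a b n p q →
    ∃[ t ] t < suc n × x ≡ q + t * b × y ≡ p + (n ∸ t) * a
  representations-of-canonical {n} {p} {q} {x} {y} p<a q<b rep =
    t , s≤s t≤n , trans (m≡m%n+[m/n]*n x b) (cong (_+ t * b) residue≡q) , y≡
    where
    t = x / b
    reduced : x % b * a + (y + t * a) * b ≡ q * a + (p + n * a) * b
    reduced = trans (sym (reduce-mod-b x y)) rep
    residue≡q : x % b ≡ q
    residue≡q = residue-unique (y + t * a) (p + n * a) (m%n<n x b) q<b reduced
    quotients : y + t * a ≡ p + n * a
    quotients = *-cancelʳ-≡ _ _ b
      (+-cancelˡ-≡ (q * a) _ _
        (subst (λ r → r * a + (y + t * a) * b ≡ q * a + (p + n * a) * b) residue≡q reduced))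
    t≤n : t ≤ n
    t≤n = ≮⇒≥ λ n<t → <-irrefl (sym quotients) (begin-strict
      p + n * a  <⟨ +-monoˡ-< (n * a) p<a ⟩
      a + n * a  ≤⟨ *-monoˡ-≤ a n<t ⟩
      t * a      ≤⟨ m≤n+m (t * a) y ⟩
      y + t * a  ∎)
      where open ≤-Reasoning
    y≡ : y ≡ p + (n ∸ t) * a
    y≡ = +-cancelʳ-≡ (t * a) y (p + (n ∸ t) * a) (begin
      y + t * a                  ≡⟨ quotients ⟩
      p + n * a                  ≡⟨ cong (λ s → p + s * a) (sym (m∸n+n≡m t≤n)) ⟩
      p + (n ∸ t + t) * a        ≡⟨ regroup p (n ∸ t) t a ⟩
      p + (n ∸ t) * a + t * a    ∎)
      where
      open ≡-Reasoning
      regroup : ∀ p s t a → p + (s + t) * a ≡ p + s * a + t * a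
      regroup = solve-∀

  coefficients-bounded : ∀ {x y j} → x * a + y * b ≡ j → x ≤ j × y ≤ j
  coefficients-bounded {x} {y} rep =
    subst (x ≤_) rep (≤-trans (m≤m*n x a) (m≤m+n (x * a) (y * b))) ,
    subst (y ≤_) rep (≤-trans (m≤m*n y b) (m≤n+m (y * b) (x * a)))

  numReps-canonical : ∀ n {p q} → p < a → q < b → numReps a b (canonical a b n p q) ≡ suc n
  numReps-canonical n {p} {q} p<a q<b =
    count-parametrised (suc j) (suc n) (λ x y → x * a + y * b ≡ᵇ j) X Y X-injective parametrisation
      (λ x y test → representations-of-canonical p<a q<b (≡ᵇ-sound test))
    where
    j = canonical a b n p q
    X Y : ℕ → ℕ
    X t = q + t * b
    Y t = p + (n ∸ t) * a
    X-injective : ∀ {t t'} → X t ≡ X t' → t ≡ t'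
    X-injective {t} {t'} same = *-cancelʳ-≡ t t' b (+-cancelˡ-≡ q _ _ same)
    parametrisation : ∀ t → t < suc n → X t < suc j × Y t < suc j × (X t * a + Y t * b ≡ᵇ j) ≡ true
    parametrisation t t<1+n with canonical-representation {n} {p} {q} (≤-pred t<1+n)
    ... | rep with coefficients-bounded rep
    ...   | Xt≤j , Yt≤j = s≤s Xt≤j , s≤s Yt≤j , ≡ᵇ-complete rep

  representable : ∀ {j} → numReps a b j ≢ 0 → ∃[ x ] ∃[ y ] x * a + y * b ≡ j
  representable {j} count≢0 with sum-nonzero (suc j) _ count≢0
  ... | x , _ , row≢0 with sum-nonzero (suc j) _ row≢0
  ...   | y , _ , term≢0 with x * a + y * b ≟ j
  ...     | yes rep  = x , y , rep
  ...     | no  ¬rep = ⊥-elim (term≢0 (if-≡ᵇ-no 1 0 ¬rep))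

  numReps-suc⇒canonical : ∀ n j → numReps a b j ≡ suc n →
    ∃[ p ] ∃[ q ] p < a × q < b × j ≡ canonical a b n p q
  numReps-suc⇒canonical n j count with representable (λ count≡0 → 1+n≢0 (trans (sym count) count≡0))
  ... | x , y , rep with canonical-form x y
  ...   | K , p , q , p<a , q<b , rep′ =
    p , q , p<a , q<b , subst (λ k → j ≡ canonical a b k p q) K≡n j≡canonical
    where
    j≡canonical : j ≡ canonical a b K p q
    j≡canonical = trans (sym rep) rep′
    K≡n : K ≡ n
    K≡n = suc-injective (begin
      suc K                                ≡⟨ sym (numReps-canonical K p<a q<b) ⟩
      numReps a b (canonical a b K p q)    ≡⟨ cong (numReps a b) (sym j≡canonical) ⟩
      numReps a b j                        ≡⟨ count ⟩
      suc n                                ∎)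
      where open ≡-Reasoning

  canonical-injective : ∀ n {p q p' q'} → q < b → q' < b →
    canonical a b n p q ≡ canonical a b n p' q' → p ≡ p' × q ≡ q'
  canonical-injective n {p} {q} {p'} {q'} q<b q'<b same = p≡p' , q≡q'
    where
    q≡q' : q ≡ q'
    q≡q' = residue-unique (p + n * a) (p' + n * a) q<b q'<b same
    p≡p' : p ≡ p'
    p≡p' = +-cancelʳ-≡ (n * a) p p' (*-cancelʳ-≡ _ _ b
      (+-cancelˡ-≡ (q * a) _ _
        (subst (λ r → q * a + (p + n * a) * b ≡ r * a + (p' + n * a) * b) (sym q≡q') same)))

  -- canonical a b n p q is increasing in p and q, so all of them lie below
  -- canonical a b n a b.
  canonical-below : ∀ n {p q} → p < a → q < b → canonical a b n p q < canonical a b n a b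
  canonical-below n {p} {q} p<a q<b = +-mono-≤-< q*a≤b*a (*-monoˡ-< b (+-monoˡ-< (n * a) p<a))
    where
    q*a≤b*a : q * a ≤ b * a
    q*a≤b*a = *-monoˡ-≤ a (<⇒≤ q<b)

  no-reps-beyond : ∀ n j → j ≥ canonical a b n a b → numReps a b j ≢ suc n
  no-reps-beyond n j j≥bound count =
    let p , q , p<a , q<b , j≡canonical = numReps-suc⇒canonical n j count
    in <⇒≱ (subst (_< canonical a b n a b) (sym j≡canonical) (canonical-below n p<a q<b)) j≥bound

  partialS-canonical : ∀ n m →
    partialS (suc n) m a b (canonical a b n a b) ≡ sumBelow a (λ p → sumBelow b (λ q → canonical a b n p q ^ m))
  partialS-canonical n m =
    sum-reindex (canonical a b n a b) a b (λ j → numReps a b j ≡ᵇ suc n) (canonical a b n) (_^ m)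
      (λ _ q<b _ q'<b → canonical-injective n q<b q'<b)
      (λ p q p<a q<b → canonical-below n p<a q<b , ≡ᵇ-complete (numReps-canonical n p<a q<b))
      (λ j test → numReps-suc⇒canonical n j (≡ᵇ-sound {numReps a b j} test))

β-power-sum : ∀ v x → β (v + 1) x ≡ sumBelow x (λ j → j ^ v)
β-power-sum v x = sum-cong x (λ j _ → cong (j ^_) (m+n∸n≡m v 1))

rhs-term : ∀ n m a b l u →
  multinomial m l u (m ∸ l ∸ u) * a ^ (l + u) * b ^ (l + (m ∸ l ∸ u)) * n ^ l
    * β ((m ∸ l ∸ u) + 1) a * β (u + 1) b
  ≡ sumBelow a (λ p → sumBelow b (λ q →
      multinomial m l u (m ∸ l ∸ u) * (n * (a * b)) ^ l * (a * q) ^ u * (b * p) ^ (m ∸ l ∸ u)))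
rhs-term n m a b l u = begin
  c * β (v + 1) a * β (u + 1) b
    ≡⟨ cong₂ (λ s t → c * s * t) (β-power-sum v a) (β-power-sum u b) ⟩
  c * sumBelow a (λ p → p ^ v) * sumBelow b (λ q → q ^ u)
    ≡⟨ sum-product a b c (λ p → p ^ v) (λ q → q ^ u) ⟩
  sumBelow a (λ p → sumBelow b (λ q → c * p ^ v * q ^ u))
    ≡⟨ sum-cong a (λ p _ → sum-cong b (λ q _ → expand p q)) ⟩
  sumBelow a (λ p → sumBelow b (λ q → M * (n * (a * b)) ^ l * (a * q) ^ u * (b * p) ^ v)) ∎
  where
  open ≡-Reasoning
  v = m ∸ l ∸ u
  M = multinomial m l u v
  c = M * a ^ (l + u) * b ^ (l + v) * n ^ l
  regroup : ∀ M al au bl bv nl pv qu →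
    M * (al * au) * (bl * bv) * nl * pv * qu ≡ M * (nl * (al * bl)) * (au * qu) * (bv * pv)
  regroup = solve-∀
  expand : ∀ p q → c * p ^ v * q ^ u ≡ M * (n * (a * b)) ^ l * (a * q) ^ u * (b * p) ^ v
  expand p q
    rewrite ^-distribˡ-+-* a l u | ^-distribˡ-+-* b l v
          | ^-distrib-* n (a * b) l | ^-distrib-* a b l | ^-distrib-* a q u | ^-distrib-* b p v
    = regroup M (a ^ l) (a ^ u) (b ^ l) (b ^ v) (n ^ l) (p ^ v) (q ^ u)

canonical-expanded : ∀ a b n p q → q * a + (p + n * a) * b ≡ n * (a * b) + (a * q + b * p)
canonical-expanded = solve-∀

rhs-canonical : ∀ n m a b →
  rhs (suc n) m a b ≡ sumBelow a (λ p → sumBelow b (λ q → canonical a b n p q ^ m))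
rhs-canonical n m a b = begin
  rhs (suc n) m a b
    ≡⟨ sum-cong (suc m) (λ l _ → sum-cong (suc (m ∸ l)) (λ u _ → rhs-term n m a b l u)) ⟩
  sumBelow (suc m) (λ l → sumBelow (suc (m ∸ l)) (λ u → sumBelow a (λ p → sumBelow b (λ q → F l u p q))))
    ≡⟨ sum-swap-pairs (suc m) (λ l → suc (m ∸ l)) a b F ⟩
  sumBelow a (λ p → sumBelow b (λ q → sumBelow (suc m) (λ l → sumBelow (suc (m ∸ l)) (λ u → F l u p q))))
    ≡⟨ sum-cong a (λ p _ → sum-cong b (λ q _ → sym (trinomial m (n * (a * b)) (a * q) (b * p)))) ⟩
  sumBelow a (λ p → sumBelow b (λ q → (n * (a * b) + (a * q + b * p)) ^ m))
    ≡⟨ sum-cong a (λ p _ → sum-cong b (λ q _ → cong (_^ m) (sym (canonical-expanded a b n p q)))) ⟩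
  sumBelow a (λ p → sumBelow b (λ q → canonical a b n p q ^ m)) ∎
  where
  open ≡-Reasoning
  F : ℕ → ℕ → ℕ → ℕ → ℕ
  F l u p q = multinomial m l u (m ∸ l ∸ u) * (n * (a * b)) ^ l * (a * q) ^ u * (b * p) ^ (m ∸ l ∸ u)

theorem4 : (a b k m : ℕ) → 1 ≤ a → 1 ≤ b → Coprime a b → 1 ≤ k →
    Σ ℕ (λ N → ((j : ℕ) → j ≥ N → numReps a b j ≢ k)
    × (partialS k m a b N ≡ rhs k m a b))
theorem4 a@(suc _) b@(suc _) (suc n) m _ _ coprime _ =
  canonical a b n a b ,
  no-reps-beyond n ,
  trans (partialS-canonical n m) (sym (rhs-canonical n m a b))
  where open Representations a b coprime
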